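{- Let $R$ be a principal ideal ring. Let $G$ be a finite graph with an edge-labeling by ideals of $R$, and let $G^+$ be obtained from $G$ by adding a vertex $v$ together with some edges between $v$ and vertices of $G$, each new edge labeled by an ideal of $R$. Let $N$ be the least common multiple of the labels on the edges incident to $v$. Let $M_v\subseteq R_{G^+}$ be the set of splines on $G^+$ that are zero at every vertex other than $v$, and let $\pi:R_{G^+}\to R_G$ be the map forgetting the value at $v$. Then $\ker\pi\cong M_v\cong NR$.
   Context: For a finite graph $G=(V,E)$, a commutative ring $R$ with identity and an edge-labeling $\alpha:E\to\{\text{ideals of }R\}$, a spline is $f\in R^{|V|}$ with $f_u-f_v\in\alpha(uv)$ for every edge $uv$; $R_G$ denotes the set of splines. The restriction of a spline on $G^+$ to the vertices of $G$ is a spline on $G$, so $\pi$ is well defined. Here the least common multiple $N$ of the labels means a generator of the intersection of the (principal) ideals labeling the edges incident to $v$. -}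

module Defs where

open import Level using (Level; _⊔_; suc)
open import Data.Nat using (ℕ)
open import Algebra.Bundles using (CommutativeRing)
open import Data.Fin using (Fin; zero) renaming (suc to fsuc)
open import Data.List using (List; map; mapMaybe; allFin; _++_)
open import Data.List.Relation.Unary.All using (All)
open import Data.Maybe using (Maybe; just; nothing)
open import Data.Product using (Σ; ∃; _×_; _,_)
open import Function.Bundles using (_⇔_)
open import Relation.Binary.PropositionalEquality using (_≡_)

module _ {c ℓ : Level} (R : CommutativeRing c ℓ) where
  open CommutativeRing R hiding (zero)

  _−_ : Carrier → Carrier → Carrier
  x − y = x + (- y)

  record Ideal (ℓ′ : Level) : Set (c ⊔ ℓ ⊔ suc ℓ′) where
    field
      _∈I : Carrier → Set ℓ′
      ∈-resp-≈ : ∀ {x y} → x ≈ y → x ∈I → y ∈I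
      0∈ : 0# ∈I
      +-closed : ∀ {x y} → x ∈I → y ∈I → (x + y) ∈I
      *-closed : ∀ r {x} → x ∈I → (r * x) ∈I
  open Ideal public

  _∈ᵢ_ : ∀ {ℓ′} → Carrier → Ideal ℓ′ → Set ℓ′
  x ∈ᵢ I = _∈I I x

  _∈⟨_⟩ : Carrier → Carrier → Set (c ⊔ ℓ)
  x ∈⟨ g ⟩ = ∃ λ r → x ≈ g * r

  IsPrincipalIdealRing : (ℓ′ : Level) → Set (c ⊔ ℓ ⊔ suc ℓ′)
  IsPrincipalIdealRing ℓ′ =
    (I : Ideal ℓ′) → ∃ λ g → ∀ x → (x ∈ᵢ I) ⇔ (x ∈⟨ g ⟩)

  LabelledGraph : (ℓ′ : Level) → (n : ℕ) → Set (c ⊔ ℓ ⊔ suc ℓ′)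
  LabelledGraph ℓ′ n = List (Fin n × Fin n × Ideal ℓ′)

  IsSpline : ∀ {ℓ′ n} → LabelledGraph ℓ′ n → (Fin n → Carrier) → Set (c ⊔ ℓ ⊔ suc ℓ′)
  IsSpline G f = All (λ { (u , w , I) → (f u − f w) ∈ᵢ I }) G

  -- G⁺ : add a new vertex v = zero (old vertex i becomes fsuc i).
  -- newE i = just I means there is a new edge v – i labelled I.
  newEdge : ∀ {ℓ′ n} → (Fin n → Maybe (Ideal ℓ′)) → Fin n →
            Maybe (Fin (ℕ.suc n) × Fin (ℕ.suc n) × Ideal ℓ′)
  newEdge newE i with newE i
  ... | just I  = just (zero , fsuc i , I)
  ... | nothing = nothing

  addVertex : ∀ {ℓ′ n} → LabelledGraph ℓ′ n → (Fin n → Maybe (Ideal ℓ′)) →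
              LabelledGraph ℓ′ (ℕ.suc n)
  addVertex {n = n} G newE =
    mapMaybe (newEdge newE) (allFin n)
    ++ map (λ { (u , w , I) → (fsuc u , fsuc w , I) }) G

  π : ∀ {n} → (Fin (ℕ.suc n) → Carrier) → Fin n → Carrier
  π f i = f (fsuc i)

  -- Isomorphism of R-modules between two subsets P ⊆ R^k, Q ⊆ R^m
  -- (subsets closed under the module operations): R-linear maps
  -- P → Q and Q → P, respecting equality, mutually inverse.
  record _≅ₘ_ {k m : ℕ} {p q : Level}
              (P : (Fin k → Carrier) → Set p) (Q : (Fin m → Carrier) → Set q)
              : Set (c ⊔ ℓ ⊔ p ⊔ q) where
    field
      to       : (Fin k → Carrier) → Fin m → Carrier
      from     : (Fin m → Carrier) → Fin k → Carrier
      to-mem   : ∀ x → P x → Q (to x)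
      from-mem : ∀ y → Q y → P (from y)
      to-cong  : ∀ x x′ → P x → P x′ → (∀ i → x i ≈ x′ i) → ∀ j → to x j ≈ to x′ j
      from-cong : ∀ y y′ → Q y → Q y′ → (∀ j → y j ≈ y′ j) → ∀ i → from y i ≈ from y′ i
      to-+     : ∀ x x′ → P x → P x′ → ∀ j → to (λ i → x i + x′ i) j ≈ to x j + to x′ j
      to-*     : ∀ r x → P x → ∀ j → to (λ i → r * x i) j ≈ r * to x j
      from∘to  : ∀ x → P x → ∀ i → from (to x) i ≈ x i
      to∘from  : ∀ y → Q y → ∀ j → to (from y) j ≈ y j

module Submission where

-- A vector on G⁺ is a
-- spline exactly when it satisfies the conditions on the new edges v – i and
-- its restriction π f is a spline on G (spline⁺⇔).  The kernel of π and M_v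
-- are the same set of vectors, namely the splines vanishing off v, so the
-- identity map is the first isomorphism (≅ₘ-from-⇔).  For a vector f that
-- vanishes off v, every condition on an old edge reads 0 − 0 ∈ α(uw) and
-- holds automatically, while the condition on a new edge v – i reads
-- f(v) − 0 ∈ α(vi); so f is a spline iff f(v) lies in every new label, i.e.
-- iff f(v) ∈ NR (supported-spline⇔).  Evaluation at v and extension by zero
-- are then mutually inverse linear maps M_v ≅ NR (evalAtZero-iso).
-- The principal-ideal hypothesis enters only through the existence of N,
-- which the statement supplies as the generator of the intersection.

open import Defs
import Level
open import Level using (Level; _⊔_)
open import Algebra.Bundles using (CommutativeRing)
open import Data.Nat using (ℕ)
open import Data.Fin using (Fin; zero; suc)
open import Data.Maybe using (Maybe; just; nothing)
open import Data.Product using (_×_; _,_; proj₁; proj₂)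
open import Function.Bundles using (_⇔_; mk⇔; Equivalence)
open import Relation.Binary.PropositionalEquality using (_≡_; _≢_; refl)

open import Data.Empty using (⊥-elim)
open import Data.List using (List; []; _∷_; catMaybes; mapMaybe; allFin)
open import Data.List.Relation.Unary.All as All using (All; []; _∷_)
import Data.List.Relation.Unary.All.Properties as AllP
import Data.Maybe.Relation.Unary.All as MaybeAll
import Algebra.Properties.Ring as RingProperties

catMaybes⁻ : ∀ {a p} {A : Set a} {P : A → Set p} (xs : List (Maybe A)) →
             All P (catMaybes xs) → All (MaybeAll.All P) xs
catMaybes⁻ []            []       = []
catMaybes⁻ (nothing ∷ xs) ps      = MaybeAll.nothing ∷ catMaybes⁻ xs ps
catMaybes⁻ (just x ∷ xs) (p ∷ ps) = MaybeAll.just p ∷ catMaybes⁻ xs ps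

module _ {c ℓ : Level} (R : CommutativeRing c ℓ) where
  open CommutativeRing R hiding (zero) renaming (refl to ≈-refl)
  open RingProperties ring using (-0#≈0#)
  open import Relation.Binary.Reasoning.Setoid setoid

  −-zeroʳ : ∀ {x y} → y ≈ 0# → _−_ R x y ≈ x
  −-zeroʳ {x} {y} y≈0 = begin
    x + - y  ≈⟨ +-congˡ (-‿cong y≈0) ⟩
    x + - 0# ≈⟨ +-congˡ -0#≈0# ⟩
    x + 0#   ≈⟨ +-identityʳ x ⟩
    x        ∎

  vanishing-spline : ∀ {ℓ′ n} (G : LabelledGraph R ℓ′ n) (g : Fin n → Carrier) →
                     (∀ i → g i ≈ 0#) → IsSpline R G g
  vanishing-spline []              g g≈0 = []
  vanishing-spline ((u , w , I) ∷ G) g g≈0 =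
    ∈-resp-≈ I (sym (trans (−-zeroʳ (g≈0 w)) (g≈0 u))) (0∈ I) ∷ vanishing-spline G g g≈0

  NewEdgeConditions : ∀ {ℓ′ n} → (Fin n → Maybe (Ideal R ℓ′)) →
                      (Fin (ℕ.suc n) → Carrier) → Set (c ⊔ ℓ ⊔ Level.suc ℓ′)
  NewEdgeConditions newE f =
    ∀ i I → newE i ≡ just I → _∈ᵢ_ R (_−_ R (f zero) (f (suc i))) I

  spline⁺⇔ : ∀ {ℓ′ n} (G : LabelledGraph R ℓ′ n) (newE : Fin n → Maybe (Ideal R ℓ′))
             (f : Fin (ℕ.suc n) → Carrier) →
             IsSpline R (addVertex R G newE) f ⇔
             (NewEdgeConditions newE f × IsSpline R G (π R f))
  spline⁺⇔ {ℓ′} {n} G newE f = mk⇔ split join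
    where
    NewEdgeOK : Fin n → Set (c ⊔ ℓ ⊔ Level.suc ℓ′)
    NewEdgeOK i = MaybeAll.All (λ { (u , w , I) → _∈ᵢ_ R (_−_ R (f u) (f w)) I })
                               (newEdge R newE i)

    fromOK : (∀ i → NewEdgeOK i) → NewEdgeConditions newE f
    fromOK ok i I eq with newE i | ok i
    fromOK ok i I refl | just .I | MaybeAll.just p = p

    toOK : NewEdgeConditions newE f → ∀ i → NewEdgeOK i
    toOK cond i with newE i in eq
    ... | just I  = MaybeAll.just (cond i I eq)
    ... | nothing = MaybeAll.nothing

    split : IsSpline R (addVertex R G newE) f →
            NewEdgeConditions newE f × IsSpline R G (π R f)
    split s =
      let (new , old) = AllP.++⁻ (mapMaybe (newEdge R newE) (allFin n)) s
          newOK = AllP.tabulate⁻ (AllP.map⁻ (catMaybes⁻ _ new))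
      in fromOK newOK
       , All.map (λ { {_ , _ , _} p → p }) (AllP.map⁻ old)

    join : NewEdgeConditions newE f × IsSpline R G (π R f) →
           IsSpline R (addVertex R G newE) f
    join (cond , old) =
      AllP.++⁺ (AllP.mapMaybe⁺ (AllP.map⁺ (AllP.tabulate⁺ (toOK cond))))
               (AllP.map⁺ (All.map (λ { {_ , _ , _} p → p }) old))

  SupportedAtZero : ∀ {n} → (Fin (ℕ.suc n) → Carrier) → Set ℓ
  SupportedAtZero f = ∀ w → w ≢ zero → f w ≈ 0#

  supported⇔ker : ∀ {n} (f : Fin (ℕ.suc n) → Carrier) →
                  SupportedAtZero f ⇔ (∀ i → π R f i ≈ 0#)
  supported⇔ker f = mk⇔ (λ s i → s (suc i) (λ ()))
                        (λ { k zero      v≢v → ⊥-elim (v≢v refl)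
                           ; k (suc i) _   → k i })

  supported-spline⇔ : ∀ {ℓ′ n} (G : LabelledGraph R ℓ′ n)
    (newE : Fin n → Maybe (Ideal R ℓ′)) (N : Carrier) →
    (∀ x → (∀ i I → newE i ≡ just I → _∈ᵢ_ R x I) ⇔ (_∈⟨_⟩ R x N)) →
    (f : Fin (ℕ.suc n) → Carrier) → SupportedAtZero f →
    IsSpline R (addVertex R G newE) f ⇔ _∈⟨_⟩ R (f zero) N
  supported-spline⇔ G newE N hN f supp = mk⇔ toN fromN
    where
    f[i]≈0 : ∀ i → f (suc i) ≈ 0#
    f[i]≈0 i = supp (suc i) (λ ())

    toN : IsSpline R (addVertex R G newE) f → _∈⟨_⟩ R (f zero) N
    toN s = Equivalence.to (hN (f zero)) λ i I eq →
      ∈-resp-≈ I (−-zeroʳ (f[i]≈0 i))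
        (proj₁ (Equivalence.to (spline⁺⇔ G newE f) s) i I eq)

    fromN : _∈⟨_⟩ R (f zero) N → IsSpline R (addVertex R G newE) f
    fromN f[v]∈N = Equivalence.from (spline⁺⇔ G newE f)
      ( (λ i I eq → ∈-resp-≈ I (sym (−-zeroʳ (f[i]≈0 i)))
                      (Equivalence.from (hN (f zero)) f[v]∈N i I eq))
      , vanishing-spline G (π R f) f[i]≈0 )

  ≅ₘ-from-⇔ : ∀ {k p q} {P : (Fin k → Carrier) → Set p} {Q : (Fin k → Carrier) → Set q} →
              (∀ f → P f ⇔ Q f) → _≅ₘ_ R P Q
  ≅ₘ-from-⇔ P⇔Q = record
    { to        = λ f → f
    ; from      = λ f → f
    ; to-mem    = λ f → Equivalence.to (P⇔Q f)
    ; from-mem  = λ f → Equivalence.from (P⇔Q f)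
    ; to-cong   = λ _ _ _ _ f≈f′ → f≈f′
    ; from-cong = λ _ _ _ _ f≈f′ → f≈f′
    ; to-+      = λ _ _ _ _ _ → ≈-refl
    ; to-*      = λ _ _ _ _ → ≈-refl
    ; from∘to   = λ _ _ _ → ≈-refl
    ; to∘from   = λ _ _ _ → ≈-refl
    }

  extendByZero : ∀ {n} → Carrier → Fin (ℕ.suc n) → Carrier
  extendByZero x zero    = x
  extendByZero x (suc _) = 0#

  evalAtZero-iso : ∀ {n p q} {P : (Fin (ℕ.suc n) → Carrier) → Set p} {Q : Carrier → Set q} →
    (∀ f → P f → SupportedAtZero f) → (∀ f → P f → Q (f zero)) →
    (∀ x → Q x → P (extendByZero x)) →
    _≅ₘ_ R P (λ (y : Fin 1 → Carrier) → Q (y zero))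
  evalAtZero-iso supp toQ fromP = record
    { to        = λ f _ → f zero
    ; from      = λ y → extendByZero (y zero)
    ; to-mem    = toQ
    ; from-mem  = λ y → fromP (y zero)
    ; to-cong   = λ _ _ _ _ f≈f′ _ → f≈f′ zero
    ; from-cong = λ { _ _ _ _ y≈y′ zero → y≈y′ zero ; _ _ _ _ _ (suc _) → ≈-refl }
    ; to-+      = λ _ _ _ _ _ → ≈-refl
    ; to-*      = λ _ _ _ _ → ≈-refl
    ; from∘to   = λ { _ _ zero → ≈-refl ; f Pf (suc i) → sym (supp f Pf (suc i) (λ ())) }
    ; to∘from   = λ { _ _ zero → ≈-refl }
    }

mainTheorem8 : ∀ {c ℓ ℓ′} (R : CommutativeRing c ℓ) →
    let open CommutativeRing R hiding (zero) in
    IsPrincipalIdealRing R ℓ′ →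
    (n : ℕ) (G : LabelledGraph R ℓ′ n) (newE : Fin n → Maybe (Ideal R ℓ′)) →
    (N : Carrier) →
    (∀ x → (∀ i I → newE i ≡ just I → _∈ᵢ_ R x I) ⇔ (_∈⟨_⟩ R x N)) →
    let Gp = addVertex R G newE
        KerP = λ (f : Fin (ℕ.suc n) → Carrier) → IsSpline R Gp f × (∀ i → π R f i ≈ 0#)
        MvP = λ (f : Fin (ℕ.suc n) → Carrier) → IsSpline R Gp f × (∀ w → w ≢ zero → f w ≈ 0#)
        NRP = λ (x : Fin 1 → Carrier) → _∈⟨_⟩ R (x zero) N
    in _≅ₘ_ R KerP MvP × _≅ₘ_ R MvP NRP
mainTheorem8 {c} {ℓ} {ℓ′} R _ n G newE N hN = ker≅Mv , Mv≅NR
  where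
  open CommutativeRing R using (Carrier; _≈_; 0#) renaming (refl to ≈-refl)

  Spline⁺ : (Fin (ℕ.suc n) → Carrier) → Set (c ⊔ ℓ ⊔ Level.suc ℓ′)
  Spline⁺ = IsSpline R (addVertex R G newE)

  ker≅Mv : _≅ₘ_ R (λ f → Spline⁺ f × (∀ i → π R f i ≈ 0#))
                  (λ f → Spline⁺ f × SupportedAtZero R f)
  ker≅Mv = ≅ₘ-from-⇔ R λ f → mk⇔
    (λ (s , k) → s , Equivalence.from (supported⇔ker R f) k)
    (λ (s , supp) → s , Equivalence.to (supported⇔ker R f) supp)

  Mv≅NR : _≅ₘ_ R (λ f → Spline⁺ f × SupportedAtZero R f) (λ y → _∈⟨_⟩ R (y zero) N)
  Mv≅NR = evalAtZero-iso R
    (λ _ → proj₂)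
    (λ f (s , supp) → Equivalence.to (supported-spline⇔ R G newE N hN f supp) s)
    (λ x x∈N → let supp = Equivalence.from (supported⇔ker R (extendByZero R x)) (λ _ → ≈-refl)
               in Equivalence.from (supported-spline⇔ R G newE N hN _ supp) x∈N , supp)
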